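{- Let $M\in\{0,1\}^{m\times n}$ and $J=\overline{\overline{M}^T\circ M}\in\{0,1\}^{n\times n}$. Then for all $i,j\in\{1,\ldots,n\}$: (a) $J[i,j]=1\iff M[:,i]\ge M[:,j]$; (b) $J[i,j]=J[j,i]=1\iff M[:,i]=M[:,j]\iff \big(J[:,i]=J[:,j]$ and $J[i,:]=J[j,:]\big)$; (c) $\big(J[i,j]=1$ and $J[j,i]=0\big)\iff M[:,i]>M[:,j]$, and in this case $J[:,j]>J[:,i]$ and $J[j,:]<J[i,:]$.
   Context: $\circ$ denotes the Boolean matrix product $(X\circ Y)_{ij}=\bigvee_t (x_{it}\wedge y_{tj})$; $\overline{X}$ is the entrywise complement; $X^T$ the transpose. $X[:,j]$ and $X[i,:]$ denote the $j$-th column and $i$-th row of $X$. For Boolean vectors of the same shape, $\mathbf{p}\ge\mathbf{q}$ means $p_t\ge q_t$ for all $t$ (with $1>0$), and $\mathbf{p}>\mathbf{q}$ means $\mathbf{p}\ge\mathbf{q}$ and $p_t>q_t$ for some $t$; $\mathbf{p}<\mathbf{q}$ means $\mathbf{q}>\mathbf{p}$. -}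

module Defs where

open import Data.Nat using (ℕ; zero; suc)
open import Data.Fin using (Fin; zero; suc)
open import Data.Bool using (Bool; true; false; _∧_; _∨_; not)
import Data.Bool as B
open import Data.Product using (_×_; Σ)
open import Relation.Binary.PropositionalEquality using (_≡_)

BMat : ℕ → ℕ → Set
BMat m n = Fin m → Fin n → Bool

BVec : ℕ → Set
BVec k = Fin k → Bool

⋁ : {k : ℕ} → (Fin k → Bool) → Bool
⋁ {zero}  f = false
⋁ {suc k} f = f zero ∨ ⋁ (λ t → f (suc t))

_∘ᵇ_ : {m k n : ℕ} → BMat m k → BMat k n → BMat m n
(X ∘ᵇ Y) i j = ⋁ (λ t → X i t ∧ Y t j)

comp : {m n : ℕ} → BMat m n → BMat m n
comp X i j = not (X i j)

transp : {m n : ℕ} → BMat m n → BMat n m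
transp X i j = X j i

col : {m n : ℕ} → BMat m n → Fin n → BVec m
col X j i = X i j

row : {m n : ℕ} → BMat m n → Fin m → BVec n
row X i j = X i j

_≥ᵛ_ : {k : ℕ} → BVec k → BVec k → Set
p ≥ᵛ q = ∀ t → q t B.≤ p t

_>ᵛ_ : {k : ℕ} → BVec k → BVec k → Set
p >ᵛ q = (p ≥ᵛ q) × Σ _ (λ t → q t B.< p t)

_<ᵛ_ : {k : ℕ} → BVec k → BVec k → Set
p <ᵛ q = q >ᵛ p

_≗ᵛ_ : {k : ℕ} → BVec k → BVec k → Set
p ≗ᵛ q = ∀ t → p t ≡ q t

Jmat : {m n : ℕ} → BMat m n → BMat n n
Jmat M = comp (transp (comp M) ∘ᵇ M)

module Submission where

-- Entry (i, j) of ¬Mᵀ ∘ M is ⋁ₜ (¬M[t,i] ∧ M[t,j]): it is true exactly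
-- when some row t has M[t,i] < M[t,j].  Hence J[i,j] is the Boolean test
-- "M[:,i] ≥ M[:,j]", and when the test fails it comes with a witness row.  Since
-- dominance is a preorder, J is reflexive and transitive; the remaining
-- claims about rows and columns of J hold for the indicator matrix of any
-- preorder on Fin n, which is proved once in that generality.

open import Defs
open import Data.Nat using (ℕ; suc)
open import Data.Fin using (Fin; zero; suc)
open import Data.Bool using (Bool; true; false; not; _∧_)
import Data.Bool as B
import Data.Bool.Properties as BP
open import Data.Product using (_×_; _,_; Σ)
open import Data.Product.Function.NonDependent.Propositional using (_×-⇔_)
open import Function.Bundles using (_⇔_; mk⇔; Equivalence)
import Function.Properties.Equivalence as ⇔
open import Relation.Binary.PropositionalEquality using (_≡_; refl; sym; trans)

open Equivalence using (to; from)

⋁-false⇔ : {k : ℕ} (f : Fin k → Bool) → (⋁ f ≡ false) ⇔ (∀ t → f t ≡ false)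
⋁-false⇔ f = mk⇔ (all-false f) (none-true f)
  where
  all-false : {k : ℕ} (f : Fin k → Bool) → ⋁ f ≡ false → ∀ t → f t ≡ false
  all-false f e zero    = BP.∨-conicalˡ (f zero) _ e
  all-false f e (suc t) = all-false (λ s → f (suc s)) (BP.∨-conicalʳ (f zero) _ e) t

  none-true : {k : ℕ} (f : Fin k → Bool) → (∀ t → f t ≡ false) → ⋁ f ≡ false
  none-true {ℕ.zero} f h = refl
  none-true {suc k}  f h with f zero | h zero
  ... | false | refl = none-true (λ s → f (suc s)) (λ s → h (suc s))

⋁-true⇔ : {k : ℕ} (f : Fin k → Bool) → (⋁ f ≡ true) ⇔ Σ (Fin k) (λ t → f t ≡ true)
⋁-true⇔ f = mk⇔ (witness f) (some-true f)
  where
  witness : {k : ℕ} (f : Fin k → Bool) → ⋁ f ≡ true → Σ (Fin k) (λ t → f t ≡ true)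
  witness {suc k} f e with f zero in f₀
  ... | true  = zero , f₀
  ... | false with witness (λ s → f (suc s)) e
  ...   | t , p = suc t , p

  some-true : {k : ℕ} (f : Fin k → Bool) → Σ (Fin k) (λ t → f t ≡ true) → ⋁ f ≡ true
  some-true f (zero , p) rewrite p = refl
  some-true f (suc t , p) with f zero
  ... | true  = refl
  ... | false = some-true (λ s → f (suc s)) (t , p)

not-∧-false⇔ : (a b : Bool) → (not a ∧ b ≡ false) ⇔ (b B.≤ a)
not-∧-false⇔ a b = mk⇔ (to′ a b) (from′ a b)
  where
  to′ : (a b : Bool) → not a ∧ b ≡ false → b B.≤ a
  to′ false false _ = B.b≤b
  to′ true  false _ = B.f≤t
  to′ true  true  _ = B.b≤b

  from′ : (a b : Bool) → b B.≤ a → not a ∧ b ≡ false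
  from′ _ _ B.f≤t = refl
  from′ a _ B.b≤b = BP.∧-inverseˡ a

not-∧-true⇔ : (a b : Bool) → (not a ∧ b ≡ true) ⇔ (a B.< b)
not-∧-true⇔ a b = mk⇔ (to′ a b) (λ { B.f<t → refl })
  where
  to′ : (a b : Bool) → not a ∧ b ≡ true → a B.< b
  to′ false true _ = B.f<t

not-true⇔ : (b : Bool) → (not b ≡ true) ⇔ (b ≡ false)
not-true⇔ false = mk⇔ (λ _ → refl) (λ _ → refl)
not-true⇔ true  = mk⇔ (λ ()) (λ ())

not-false⇔ : (b : Bool) → (not b ≡ false) ⇔ (b ≡ true)
not-false⇔ false = mk⇔ (λ ()) (λ ())
not-false⇔ true  = mk⇔ (λ _ → refl) (λ _ → refl)

≤-from-⇒ : {a b : Bool} → (a ≡ true → b ≡ true) → a B.≤ b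
≤-from-⇒ {false} _ = BP.≤-minimum _
≤-from-⇒ {true}  h rewrite h refl = B.b≤b

<-from-values : {a b : Bool} → a ≡ false → b ≡ true → a B.< b
<-from-values refl refl = B.f<t

-- dominates p q is the Boolean value of p ≥ q; entry (i, j) of Jmat M is
-- definitionally  dominates (col M i) (col M j).
dominates : {k : ℕ} → BVec k → BVec k → Bool
dominates p q = not (⋁ (λ t → not (p t) ∧ q t))

dominates-true⇔ : {k : ℕ} (p q : BVec k) → (dominates p q ≡ true) ⇔ (p ≥ᵛ q)
dominates-true⇔ p q =
  ⇔.trans (not-true⇔ _) (⇔.trans (⋁-false⇔ _) (mk⇔ (λ h t → to (atom t) (h t)) (λ h t → from (atom t) (h t))))
  where
  atom : ∀ t → (not (p t) ∧ q t ≡ false) ⇔ (q t B.≤ p t)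
  atom t = not-∧-false⇔ (p t) (q t)

dominates-false⇔ : {k : ℕ} (p q : BVec k) → (dominates p q ≡ false) ⇔ Σ (Fin k) (λ t → p t B.< q t)
dominates-false⇔ p q =
  ⇔.trans (not-false⇔ _) (⇔.trans (⋁-true⇔ _) (mk⇔ (λ (t , e) → t , to (atom t) e) (λ (t , lt) → t , from (atom t) lt)))
  where
  atom : ∀ t → (not (p t) ∧ q t ≡ true) ⇔ (p t B.< q t)
  atom t = not-∧-true⇔ (p t) (q t)

≥ᵛ-refl : {k : ℕ} (p : BVec k) → p ≥ᵛ p
≥ᵛ-refl p t = BP.≤-refl

≥ᵛ-trans : {k : ℕ} {p q r : BVec k} → p ≥ᵛ q → q ≥ᵛ r → p ≥ᵛ r
≥ᵛ-trans p≥q q≥r t = BP.≤-trans (q≥r t) (p≥q t)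

≥ᵛ-antisym⇔ : {k : ℕ} (p q : BVec k) → (p ≥ᵛ q × q ≥ᵛ p) ⇔ (p ≗ᵛ q)
≥ᵛ-antisym⇔ p q = mk⇔
  (λ (p≥q , q≥p) t → BP.≤-antisym (q≥p t) (p≥q t))
  (λ p≗q → (λ t → BP.≤-reflexive (sym (p≗q t))) , (λ t → BP.≤-reflexive (p≗q t)))

record IsPreorderᵇ {n : ℕ} (R : BMat n n) : Set where
  field
    reflexive  : ∀ i → R i i ≡ true
    transitive : ∀ {i j k} → R i j ≡ true → R j k ≡ true → R i k ≡ true

module _ {n : ℕ} {R : BMat n n} (pre : IsPreorderᵇ R) where
  open IsPreorderᵇ pre

  equivalent⇔same-lines : (i j : Fin n) →
    (R i j ≡ true × R j i ≡ true) ⇔ ((col R i ≗ᵛ col R j) × (row R i ≗ᵛ row R j))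
  equivalent⇔same-lines i j = mk⇔
    (λ (ij , ji) →
        (λ k → BP.≤-antisym (≤-from-⇒ (λ ki → transitive ki ij)) (≤-from-⇒ (λ kj → transitive kj ji)))
      , (λ k → BP.≤-antisym (≤-from-⇒ (λ ik → transitive ji ik)) (≤-from-⇒ (λ jk → transitive ij jk))))
    (λ (_ , same-row) →
        trans (same-row j) (reflexive j) , trans (sym (same-row i)) (reflexive i))

  -- If i is strictly above j, then column j strictly dominates column i and
  -- row j is strictly dominated by row i; the strictness is witnessed at
  -- coordinate j, respectively i, by reflexivity.
  strict⇒strict-lines : (i j : Fin n) → R i j ≡ true → R j i ≡ false →
    (col R j >ᵛ col R i) × (row R j <ᵛ row R i)
  strict⇒strict-lines i j ij ji-false =
      ((λ k → ≤-from-⇒ (λ ki → transitive ki ij)) , (j , <-from-values ji-false (reflexive j)))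
    , ((λ k → ≤-from-⇒ (λ jk → transitive ij jk)) , (i , <-from-values ji-false (reflexive i)))

module _ {m n : ℕ} (M : BMat m n) where

  J-true⇔ : (i j : Fin n) → (Jmat M i j ≡ true) ⇔ (col M i ≥ᵛ col M j)
  J-true⇔ i j = dominates-true⇔ (col M i) (col M j)

  J-false⇔ : (i j : Fin n) → (Jmat M i j ≡ false) ⇔ Σ (Fin m) (λ t → M t i B.< M t j)
  J-false⇔ i j = dominates-false⇔ (col M i) (col M j)

  J-isPreorder : IsPreorderᵇ (Jmat M)
  J-isPreorder = record
    { reflexive  = λ i → from (J-true⇔ i i) (≥ᵛ-refl (col M i))
    ; transitive = λ {i} {j} {k} ij jk → from (J-true⇔ i k) (≥ᵛ-trans (to (J-true⇔ i j) ij) (to (J-true⇔ j k) jk))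
    }

  J-equivalent⇔ : (i j : Fin n) → (Jmat M i j ≡ true × Jmat M j i ≡ true) ⇔ (col M i ≗ᵛ col M j)
  J-equivalent⇔ i j = ⇔.trans (J-true⇔ i j ×-⇔ J-true⇔ j i) (≥ᵛ-antisym⇔ (col M i) (col M j))

  J-strict⇔ : (i j : Fin n) → (Jmat M i j ≡ true × Jmat M j i ≡ false) ⇔ (col M i >ᵛ col M j)
  J-strict⇔ i j = J-true⇔ i j ×-⇔ J-false⇔ j i

lemma5 : (m n : ℕ) (M : BMat m n) (i j : Fin n) →
    ((Jmat M i j ≡ true) ⇔ (col M i ≥ᵛ col M j))
    × (((Jmat M i j ≡ true × Jmat M j i ≡ true) ⇔ (col M i ≗ᵛ col M j))
      × ((col M i ≗ᵛ col M j) ⇔ ((col (Jmat M) i ≗ᵛ col (Jmat M) j) × (row (Jmat M) i ≗ᵛ row (Jmat M) j))))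
    × (((Jmat M i j ≡ true × Jmat M j i ≡ false) ⇔ (col M i >ᵛ col M j))
      × ((Jmat M i j ≡ true × Jmat M j i ≡ false) → ((col (Jmat M) j >ᵛ col (Jmat M) i) × (row (Jmat M) j <ᵛ row (Jmat M) i))))
lemma5 m n M i j =
    J-true⇔ M i j
  , (J-equivalent⇔ M i j , ⇔.trans (⇔.sym (J-equivalent⇔ M i j)) (equivalent⇔same-lines pre i j))
  , (J-strict⇔ M i j , λ (ij , ji) → strict⇒strict-lines pre i j ij ji)
  where
  pre : IsPreorderᵇ (Jmat M)
  pre = J-isPreorder M
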